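{- Let $S$ be a totally ordered set with $|S|=n\ge1$ and let $C=(C_1,\dots,C_n)$ be a division of $S$. Then the map $w\mapsto I^C_w$ is an injection from the set of $C$-permutations to the set of index functions of $C$. This map is a bijection if and only if $C$ is superdiagonal, i.e. $|C_1|+\dots+|C_i|\ge i$ for all $1\le i\le n$.
   Context: A division of $S$ is a sequence $C=(C_1,\dots,C_n)$ of pairwise disjoint (possibly empty) sets with union $S$ and $s<t$ whenever $s\in C_i,t\in C_j,i<j$. An element $s$ is admissible w.r.t. $C$ if it is the smallest element of $C_1$, the largest element of $C_n$, or lies in $C_i$ with $i\ne1,n$. For admissible $s\in C_i$ (and $n\ge2$), with $C_i^-=\{t\in C_i:t<s\}$, $C_i^+=\{t\in C_i:t>s\}$, the deletion $C^s$ is: if $i=1$, $(C_1^+\cup C_2,C_3,\dots,C_n)$; if $i\ne1,n$, $(C_1,\dots,C_{i-2},C_{i-1}\cup C_i^-,C_i^+\cup C_{i+1},C_{i+2},\dots,C_n)$; if $i=n$, $(C_1,\dots,C_{n-2},C_{n-1}\cup C_n^-)$; it is a division of $S\setminus\{s\}$. Write $C^{s_1\dots s_i}=(\cdots(C^{s_1})^{s_2}\cdots)^{s_i}$; a $C$-permutation is an ordering $w=w_1\dots w_n$ of $S$ such that each $w_i$ is admissible w.r.t. $C^{w_1\dots w_{i-1}}$. For a $C$-permutation $w$, the index of $w_i$ is the $j$ such that $w_i\in C^{w_1\dots w_{i-1}}_j$, and $I^C_w:S\to\mathbb N$ sends each element to its index. An index function of $C$ is any function $I:S\to\mathbb N$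 with $I(C_i)\subseteq\{1,\dots,i\}$ for every $i$. -}

module Defs where

open import Data.Nat using (ℕ; zero; suc; _≤_; _<_; _<ᵇ_)
open import Data.Nat.ListAction using (sum)
open import Data.Fin using (Fin; toℕ) renaming (_≟_ to _≟F_)
open import Data.Fin.Subset using (Subset; _∈_; _∩_; _∪_; ∣_∣)
open import Data.Fin.Subset.Properties using (_∈?_)
open import Data.Vec using (Vec; tabulate; toList)
import Data.Vec as V
open import Data.List using (List; []; _∷_; length; foldl; take; map; allFin; lookup)
open import Data.List.Relation.Binary.Permutation.Propositional using (_↭_)
open import Data.Product using (Σ; _×_; _,_; ∃)
open import Data.Sum using (_⊎_)
open import Data.Empty using (⊥)
open import Relation.Nullary using (yes; no; ¬_)
open import Relation.Binary.PropositionalEquality using (_≡_)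
open import Data.Bool using (Bool)

-- S = Fin n with its natural order; a set is a Subset n (Vec Bool n).
-- A division is a list of blocks (subsets), C_1 first.

module _ {n : ℕ} where

  below above : Fin n → Subset n
  below s = tabulate (λ t → toℕ t <ᵇ toℕ s)
  above s = tabulate (λ t → toℕ s <ᵇ toℕ t)

  -- the deletion C^s (as in the paper, for admissible s and ≥ 2 blocks;
  -- in other situations the value is irrelevant / arbitrary)
  delMid : Fin n → Subset n → List (Subset n) → List (Subset n)
  -- delMid s P Bs : P is the previous block (not containing s)
  delMid s P [] = P ∷ []
  delMid s P (B ∷ Bs) with s ∈? B
  delMid s P (B ∷ []) | yes _ = (P ∪ (B ∩ below s)) ∷ []
  delMid s P (B ∷ C ∷ Bs) | yes _ = (P ∪ (B ∩ below s)) ∷ ((B ∩ above s) ∪ C) ∷ Bs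
  ... | no _ = P ∷ delMid s B Bs

  del : Fin n → List (Subset n) → List (Subset n)
  del s [] = []
  del s (B ∷ Bs) with s ∈? B
  del s (B ∷ []) | yes _ = []
  del s (B ∷ C ∷ Bs) | yes _ = ((B ∩ above s) ∪ C) ∷ Bs
  ... | no _ = delMid s B Bs

  delAll : List (Subset n) → List (Fin n) → List (Subset n)
  delAll D w = foldl (λ E s → del s E) D w

  Admissible : List (Subset n) → Fin n → Set
  Admissible D s =
    (Σ (Fin (length D)) λ i → toℕ i ≡ 0 ×
        (s ∈ lookup D i × (∀ t → t ∈ lookup D i → toℕ s ≤ toℕ t)))
    ⊎ ((Σ (Fin (length D)) λ i → suc (toℕ i) ≡ length D ×
        (s ∈ lookup D i × (∀ t → t ∈ lookup D i → toℕ t ≤ toℕ s)))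
    ⊎ (Σ (Fin (length D)) λ i → ¬ (toℕ i ≡ 0) × (¬ (suc (toℕ i) ≡ length D) × s ∈ lookup D i)))

  CPerm : Vec (Subset n) n → List (Fin n) → Set
  CPerm C w = (w ↭ allFin n) ×
    (∀ (i : Fin (length w)) → Admissible (delAll (toList C) (take (toℕ i) w)) (lookup w i))

  -- 1-based index of the block of D containing s (0 if none)
  blockIndex : Fin n → List (Subset n) → ℕ
  blockIndex s [] = 0
  blockIndex s (B ∷ Bs) with s ∈? B
  ... | yes _ = 1
  ... | no _ = suc (blockIndex s Bs)

  indices : List (Subset n) → List (Fin n) → List (Fin n × ℕ)
  indices D [] = []
  indices D (x ∷ xs) = (x , blockIndex x D) ∷ indices (del x D) xs

  assoc : Fin n → List (Fin n × ℕ) → ℕ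
  assoc s [] = 0
  assoc s ((x , k) ∷ xs) with s ≟F x
  ... | yes _ = k
  ... | no _ = assoc s xs

  IFun : Vec (Subset n) n → List (Fin n) → Fin n → ℕ
  IFun C w s = assoc s (indices (toList C) w)

  IsDivision : Vec (Subset n) n → Set
  IsDivision C =
    (∀ i j s → ¬ (i ≡ j) → s ∈ V.lookup C i → s ∈ V.lookup C j → ⊥)
    × ((∀ s → ∃ λ i → s ∈ V.lookup C i)
    × (∀ i j s t → toℕ i < toℕ j → s ∈ V.lookup C i → t ∈ V.lookup C j → toℕ s < toℕ t))

  IsIndexFn : Vec (Subset n) n → (Fin n → ℕ) → Set
  IsIndexFn C I = ∀ (i s : Fin n) → s ∈ V.lookup C i → 1 ≤ I s × I s ≤ suc (toℕ i)

  Superdiagonal : Vec (Subset n) n → Set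
  Superdiagonal C = ∀ (i : Fin n) →
    suc (toℕ i) ≤ sum (map ∣_∣ (take (suc (toℕ i)) (toList C)))

  MapInjective : Vec (Subset n) n → Set
  MapInjective C = ∀ w w′ → CPerm C w → CPerm C w′ →
    (∀ s → IFun C w s ≡ IFun C w′ s) → w ≡ w′

  MapSurjective : Vec (Subset n) n → Set
  MapSurjective C = ∀ (I : Fin n → ℕ) → IsIndexFn C I →
    ∃ λ w → CPerm C w × (∀ s → IFun C w s ≡ I s)

module Submission where

-- Deleting an admissible x from block i moves every other element t by at most one block:
-- t drops a block exactly when it lies in a later block, or in block i below x.  Hence indices
-- never increase along a C-permutation, which gives I(C_i) ⊆ {1, …, i}; and if two
-- C-permutations begin with different x and y, deleting one of them drops the other, whose
-- index then differs between the two permutations, so w ↦ I_w is injective.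
-- Superdiagonality amounts to: an element of block k (counting from 0) has at least k smaller
-- elements, and this pointwise form survives deletion.  Under it, for an index function I,
-- call t tight if I(t) is its current block index; the least tight element of the last block
-- containing a tight element is admissible, and deleting it keeps I an index function, so
-- recursion builds a C-permutation realising I.  Conversely, a C-permutation realising
-- I(t) = (block of t) never lets an element drop, and that forces the pointwise bound.

open import Defs
open import Level using (Level)
open import Data.Nat as ℕ using (ℕ; zero; suc; _≤_; _<_; _<ᵇ_; z≤n; s≤s; _+_)
open import Data.Nat.Properties
open import Data.Nat.ListAction using (sum)
open import Data.Bool using (Bool; T)
open import Data.Bool.Properties using (T-≡)
open import Data.Fin as F using (Fin; toℕ; zero; suc; fromℕ<)
open import Data.Fin.Properties as Finₚ using (toℕ-injective; toℕ-fromℕ<; toℕ<n; any?)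
open import Data.Fin.Subset using (Subset; _∈_; _∉_; _⊆_; _∩_; _∪_; ⋃; ∣_∣; inside; outside; Nonempty)
open import Data.Fin.Subset.Properties
  using (_∈?_; x∈p∪q⁻; x∈p∪q⁺; x∈p∩q⁻; x∈p∩q⁺; ∉⊥; ⊥⊆; ∣⊥∣≡0; ⊆-antisym; ⊆⊤; ∣⊤∣≡n; drop-there; drop-∷-⊆;
         p⊆q⇒∣p∣≤∣q∣; p⊂q⇒∣p∣<∣q∣; x∈p∧x≢y⇒x∈p-y; x∈p⇒∣p-x∣<∣p∣; Empty-unique; nonempty?)
open import Data.Vec as V using (Vec; []; _∷_; here; there; tabulate; toList)
open import Data.Vec.Properties using ([]=⇒lookup; lookup⇒[]=; lookup∘tabulate; length-toList)
open import Data.List using (List; []; _∷_; length; lookup; take; map)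
open import Data.List.Membership.Propositional using () renaming (_∈_ to _∈ₗ_)
open import Data.List.Membership.Propositional.Properties using (∈-allFin)
import Data.List.Membership.Setoid.Properties as Membershipₛ
open import Data.List.Relation.Unary.Any using (here; there)
open import Data.List.Relation.Unary.All using () renaming (tabulate to All-tabulate)
open import Data.List.Relation.Unary.AllPairs using ([]; _∷_)
open import Data.List.Relation.Unary.Unique.Propositional using (Unique)
open import Data.List.Relation.Unary.Unique.Propositional.Properties using (allFin⁺)
open import Data.List.Relation.Binary.Permutation.Propositional using (_↭_; ↭-sym)
open import Data.List.Relation.Binary.Permutation.Propositional.Properties using (∈-resp-↭)
open import Data.List.Relation.Binary.BagAndSetEquality using (∼bag⇒↭)
open import Data.Product using (∃; ∃₂; _×_; _,_; proj₁; proj₂)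
open import Data.Sum using (_⊎_; inj₁; inj₂; [_,_]′)
open import Data.Empty using (⊥; ⊥-elim)
open import Function using (_∘_; Equivalence; mk↔ₛ′)
open import Relation.Nullary using (yes; no; ¬_; _×-dec_)
open import Relation.Unary using (Pred; Decidable)
open import Relation.Binary using (DecidableEquality; tri<; tri≈; tri>)
open import Relation.Binary.PropositionalEquality
open import Axiom.UniquenessOfIdentityProofs using (module Decidable⇒UIP)

open Equivalence using (to; from)

private
  variable
    m : ℕ
    ℓ : Level

-- Finite subsets

∣p∣≡1+∣q∣ : ∀ {p q : Subset m} x → x ∈ p → x ∉ q → q ⊆ p →
            (∀ {y} → y ∈ p → ¬ y ≡ x → y ∈ q) → ∣ p ∣ ≡ suc ∣ q ∣
∣p∣≡1+∣q∣ {p = inside ∷ p} {inside ∷ q} zero here x∉q q⊆p p⊆q = ⊥-elim (x∉q here)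
∣p∣≡1+∣q∣ {p = inside ∷ p} {outside ∷ q} zero here x∉q q⊆p p⊆q =
  cong suc (cong ∣_∣ (⊆-antisym (λ y∈p → drop-there (p⊆q (there y∈p) λ ())) (λ y∈q → drop-there (q⊆p (there y∈q)))))
∣p∣≡1+∣q∣ {p = inside ∷ p} {inside ∷ q} (suc x) (there x∈p) x∉q q⊆p p⊆q =
  cong suc (∣p∣≡1+∣q∣ x x∈p (x∉q ∘ there) (drop-∷-⊆ q⊆p)
    (λ y∈p y≢x → drop-there (p⊆q (there y∈p) (y≢x ∘ Finₚ.suc-injective))))
∣p∣≡1+∣q∣ {p = outside ∷ p} {outside ∷ q} (suc x) (there x∈p) x∉q q⊆p p⊆q =
  ∣p∣≡1+∣q∣ x x∈p (x∉q ∘ there) (drop-∷-⊆ q⊆p)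
    (λ y∈p y≢x → drop-there (p⊆q (there y∈p) (y≢x ∘ Finₚ.suc-injective)))
∣p∣≡1+∣q∣ {p = inside ∷ p} {outside ∷ q} (suc x) (there x∈p) x∉q q⊆p p⊆q with p⊆q here (λ ())
... | ()
∣p∣≡1+∣q∣ {p = outside ∷ p} {inside ∷ q} (suc x) (there x∈p) x∉q q⊆p p⊆q with q⊆p here
... | ()

∣p∪q∣≡∣p∣+∣q∣ : (p q : Subset m) → (∀ {x} → x ∈ p → x ∉ q) → ∣ p ∪ q ∣ ≡ ∣ p ∣ + ∣ q ∣
∣p∪q∣≡∣p∣+∣q∣ [] [] disj = refl
∣p∪q∣≡∣p∣+∣q∣ (inside ∷ p) (inside ∷ q) disj = ⊥-elim (disj here here)
∣p∪q∣≡∣p∣+∣q∣ (inside ∷ p) (outside ∷ q) disj = cong suc (∣p∪q∣≡∣p∣+∣q∣ p q (λ x∈p x∈q → disj (there x∈p) (there x∈q)))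
∣p∪q∣≡∣p∣+∣q∣ (outside ∷ p) (inside ∷ q) disj =
  trans (cong suc (∣p∪q∣≡∣p∣+∣q∣ p q (λ x∈p x∈q → disj (there x∈p) (there x∈q)))) (sym (+-suc ∣ p ∣ ∣ q ∣))
∣p∪q∣≡∣p∣+∣q∣ (outside ∷ p) (outside ∷ q) disj = ∣p∪q∣≡∣p∣+∣q∣ p q (λ x∈p x∈q → disj (there x∈p) (there x∈q))

∣tabulate-<ᵇ∣ : ∀ k → k ≤ m → ∣ tabulate {n = m} (λ u → toℕ u <ᵇ k) ∣ ≡ k
∣tabulate-<ᵇ∣ {zero} zero _ = refl
∣tabulate-<ᵇ∣ {suc m} zero _ = ∣tabulate-<ᵇ∣ {m} zero z≤n
∣tabulate-<ᵇ∣ {suc m} (suc k) (s≤s k≤m) = cong suc (∣tabulate-<ᵇ∣ k k≤m)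

∈⇒0<∣p∣ : ∀ {p : Subset m} {x} → x ∈ p → 0 < ∣ p ∣
∈⇒0<∣p∣ {m} {p} {x} x∈p = subst (_< ∣ p ∣) (∣⊥∣≡0 m) (p⊂q⇒∣p∣<∣q∣ (⊥⊆ , x , x∈p , ∉⊥))

∈-distinct⇒1<∣p∣ : ∀ {p : Subset m} {x y} → x ∈ p → y ∈ p → ¬ x ≡ y → 1 < ∣ p ∣
∈-distinct⇒1<∣p∣ x∈p y∈p x≢y = ≤-<-trans (∈⇒0<∣p∣ (x∈p∧x≢y⇒x∈p-y y∈p (x≢y ∘ sym))) (x∈p⇒∣p-x∣<∣p∣ x∈p)

0<∣p∣⇒Nonempty : ∀ {p : Subset m} → 0 < ∣ p ∣ → Nonempty p
0<∣p∣⇒Nonempty {m} {p} 0<∣p∣ with nonempty? p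
... | yes ne = ne
... | no empty = ⊥-elim (<-irrefl (sym (trans (cong ∣_∣ (Empty-unique empty)) (∣⊥∣≡0 m))) 0<∣p∣)

∈-tabulate⁻ : ∀ {f : Fin m → Bool} {u} → u ∈ tabulate f → T (f u)
∈-tabulate⁻ {f = f} {u} u∈ = T-≡ .from (trans (sym (lookup∘tabulate f u)) ([]=⇒lookup u∈))

∈-tabulate⁺ : ∀ {f : Fin m → Bool} {u} → T (f u) → u ∈ tabulate f
∈-tabulate⁺ {f = f} {u} fu = lookup⇒[]= u (tabulate f) (trans (lookup∘tabulate f u) (T-≡ .to fu))

least : ∀ {P : Pred (Fin m) ℓ} → Decidable P → ∃ P → ∃ λ s → P s × ∀ {t} → P t → toℕ s ≤ toℕ t
least {suc m} P? (t , Pt) with P? zero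
... | yes P0 = zero , P0 , λ _ → z≤n
least {suc m} P? (zero , P0) | no ¬P0 = ⊥-elim (¬P0 P0)
least {suc m} P? (suc t , Pt) | no ¬P0 = let s , Ps , minimal = least (P? ∘ suc) (t , Pt) in
    suc s , Ps , λ { {zero} P0 → ⊥-elim (¬P0 P0) ; {suc u} Pu → s≤s (minimal Pu) }

greatest : ∀ {P : Pred (Fin m) ℓ} → Decidable P → ∃ P → ∃ λ s → P s × ∀ {t} → P t → toℕ t ≤ toℕ s
greatest {suc m} P? (t , Pt) with any? (P? ∘ suc)
... | yes ∃Psuc = let s , Ps , maximal = greatest (P? ∘ suc) ∃Psuc in
    suc s , Ps , λ { {zero} _ → z≤n ; {suc u} Pu → s≤s (maximal Pu) }
greatest {suc m} P? (zero , P0) | no ¬∃Psuc = zero , P0 , λ { {zero} _ → z≤n ; {suc u} Pu → ⊥-elim (¬∃Psuc (u , Pu)) }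
greatest {suc m} P? (suc t , Pt) | no ¬∃Psuc = ⊥-elim (¬∃Psuc (t , Pt))

Unique-⇔⇒↭ : ∀ {A : Set ℓ} → DecidableEquality A → ∀ {xs ys : List A} → Unique xs → Unique ys →
             (∀ {z} → z ∈ₗ xs → z ∈ₗ ys) → (∀ {z} → z ∈ₗ ys → z ∈ₗ xs) → xs ↭ ys
Unique-⇔⇒↭ {A = A} _≟_ uxs uys xs⊆ys ys⊆xs =
  ∼bag⇒↭ (mk↔ₛ′ xs⊆ys ys⊆xs (λ _ → irrelevant uys _ _) (λ _ → irrelevant uxs _ _))
  where
    irrelevant : ∀ {zs} → Unique zs → ∀ {z} (p q : z ∈ₗ zs) → p ≡ q
    irrelevant = Membershipₛ.unique⇒irrelevant (setoid A) (Decidable⇒UIP.≡-irrelevant _≟_)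

module _ {n : ℕ} where

  -- Divisions as lists of blocks

  ∈below⁻ : ∀ {u t : Fin n} → u ∈ below t → toℕ u < toℕ t
  ∈below⁻ = <ᵇ⇒< _ _ ∘ ∈-tabulate⁻

  ∈below⁺ : ∀ {u t : Fin n} → toℕ u < toℕ t → u ∈ below t
  ∈below⁺ = ∈-tabulate⁺ ∘ <⇒<ᵇ

  ∈above⁻ : ∀ {u t : Fin n} → u ∈ above t → toℕ t < toℕ u
  ∈above⁻ = <ᵇ⇒< _ _ ∘ ∈-tabulate⁻

  ∈above⁺ : ∀ {u t : Fin n} → toℕ t < toℕ u → u ∈ above t
  ∈above⁺ = ∈-tabulate⁺ ∘ <⇒<ᵇ

  -- Blocks are counted from 0, while blockIndex and index functions count from 1.
  data InBlock (t : Fin n) : List (Subset n) → ℕ → Set where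
    inHead : ∀ {B Bs} → t ∈ B → InBlock t (B ∷ Bs) zero
    inTail : ∀ {B Bs k} → InBlock t Bs k → InBlock t (B ∷ Bs) (suc k)

  InBlock⇒<length : ∀ {t D k} → InBlock t D k → k < length D
  InBlock⇒<length (inHead _) = s≤s z≤n
  InBlock⇒<length (inTail m) = s≤s (InBlock⇒<length m)

  InBlock⇒∈⋃ : ∀ {t D k} → InBlock t D k → t ∈ ⋃ D
  InBlock⇒∈⋃ (inHead t∈B) = x∈p∪q⁺ (inj₁ t∈B)
  InBlock⇒∈⋃ (inTail m)   = x∈p∪q⁺ (inj₂ (InBlock⇒∈⋃ m))

  ∈⋃⇒InBlock : ∀ {t} D → t ∈ ⋃ D → ∃ (InBlock t D)
  ∈⋃⇒InBlock []       t∈ = ⊥-elim (∉⊥ t∈)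
  ∈⋃⇒InBlock (B ∷ Bs) t∈ with x∈p∪q⁻ B (⋃ Bs) t∈
  ... | inj₁ t∈B = zero , inHead t∈B
  ... | inj₂ t∈Bs = let k , m = ∈⋃⇒InBlock Bs t∈Bs in suc k , inTail m

  Disjoint : List (Subset n) → Set
  Disjoint D = ∀ {t k l} → InBlock t D k → InBlock t D l → k ≡ l

  blockIndex-InBlock : ∀ {t D k} → Disjoint D → InBlock t D k → blockIndex t D ≡ suc k
  blockIndex-InBlock {t} {B ∷ Bs} disj m with t ∈? B
  ... | yes t∈B = cong suc (disj (inHead t∈B) m)
  blockIndex-InBlock {t} {B ∷ Bs} disj (inHead t∈B) | no t∉B = ⊥-elim (t∉B t∈B)
  blockIndex-InBlock {t} {B ∷ Bs} disj (inTail m)   | no t∉B =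
    cong suc (blockIndex-InBlock (λ m₁ m₂ → suc-injective (disj (inTail m₁) (inTail m₂))) m)

  InBlock-take⁻ : ∀ {t : Fin n} {D j k} → InBlock t (take j D) k → InBlock t D k × k < j
  InBlock-take⁻ {D = _ ∷ _} {j = suc j} (inHead t∈) = inHead t∈ , s≤s z≤n
  InBlock-take⁻ {D = _ ∷ _} {j = suc j} (inTail mt) = let mt′ , k<j = InBlock-take⁻ mt in inTail mt′ , s≤s k<j

  InBlock-take⁺ : ∀ {t : Fin n} {D j k} → InBlock t D k → k < j → InBlock t (take j D) k
  InBlock-take⁺ (inHead t∈) (s≤s _)   = inHead t∈
  InBlock-take⁺ (inTail mt) (s≤s k<j) = inTail (InBlock-take⁺ mt k<j)

  ∣⋃∣≡sum : ∀ (D : List (Subset n)) → Disjoint D → ∣ ⋃ D ∣ ≡ sum (map ∣_∣ D)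
  ∣⋃∣≡sum []       _    = ∣⊥∣≡0 n
  ∣⋃∣≡sum (B ∷ Bs) disj = trans
    (∣p∪q∣≡∣p∣+∣q∣ B (⋃ Bs) λ t∈B t∈Bs → let _ , mt = ∈⋃⇒InBlock Bs t∈Bs in 0≢1+n (disj (inHead t∈B) (inTail mt)))
    (cong (∣ B ∣ +_) (∣⋃∣≡sum Bs (λ m₁ m₂ → suc-injective (disj (inTail m₁) (inTail m₂)))))

  ∈lookup⇒InBlock-toList : ∀ {m} (C : Vec (Subset n) m) {t} (i : Fin m) → t ∈ V.lookup C i → InBlock t (toList C) (toℕ i)
  ∈lookup⇒InBlock-toList (B V.∷ Bs) zero    t∈ = inHead t∈
  ∈lookup⇒InBlock-toList (B V.∷ Bs) (suc i) t∈ = inTail (∈lookup⇒InBlock-toList Bs i t∈)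

  InBlock-toList⇒∈lookup : ∀ {m} (C : Vec (Subset n) m) {t k} → InBlock t (toList C) k →
                           ∃ λ i → toℕ i ≡ k × t ∈ V.lookup C i
  InBlock-toList⇒∈lookup (B V.∷ Bs) (inHead t∈) = zero , refl , t∈
  InBlock-toList⇒∈lookup (B V.∷ Bs) (inTail mt) =
    let i , i≡k , t∈ = InBlock-toList⇒∈lookup Bs mt in suc i , cong suc i≡k , t∈

  -- Deleting an admissible element

  -- Moves x t i k k′ : deleting x from block i carries t from block k to block k′.
  data Moves (x t : Fin n) : ℕ → ℕ → ℕ → Set where
    stays      : ∀ {i k} → k < i → Moves x t i k k
    joinsLeft  : ∀ {j} → toℕ t < toℕ x → Moves x t (suc j) (suc j) j
    joinsRight : ∀ {i} → toℕ x < toℕ t → Moves x t i i i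
    shifts     : ∀ {i k} → i ≤ k → Moves x t i (suc k) k

  Moves-suc : ∀ {x t i k k′} → Moves x t i k k′ → Moves x t (suc i) (suc k) (suc k′)
  Moves-suc (stays k<i)      = stays (s≤s k<i)
  Moves-suc (joinsLeft t<x)  = joinsLeft t<x
  Moves-suc (joinsRight x<t) = joinsRight x<t
  Moves-suc (shifts i≤k)     = shifts (s≤s i≤k)

  Moves-pred : ∀ {x t i k k′} → Moves x t (suc (suc i)) (suc k) k′ →
               ∃ λ k″ → k′ ≡ suc k″ × Moves x t (suc i) k k″
  Moves-pred (stays (s≤s k<i)) = _ , refl , stays k<i
  Moves-pred (joinsLeft t<x)   = _ , refl , joinsLeft t<x
  Moves-pred (joinsRight x<t)  = _ , refl , joinsRight x<t
  Moves-pred (shifts (s≤s i≤k)) = _ , refl , shifts i≤k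

  Moves-≤ : ∀ {x t i k k′} → Moves x t i k k′ → k′ ≤ k
  Moves-≤ (stays _)      = ≤-refl
  Moves-≤ (joinsLeft _)  = n≤1+n _
  Moves-≤ (joinsRight _) = ≤-refl
  Moves-≤ (shifts _)     = n≤1+n _

  Moves-irrefl : ∀ {x i k′} → ¬ Moves x x i i k′
  Moves-irrefl (stays i<i)      = <-irrefl refl i<i
  Moves-irrefl (joinsLeft x<x)  = <-irrefl refl x<x
  Moves-irrefl (joinsRight x<x) = <-irrefl refl x<x
  Moves-irrefl (shifts i≤k)     = <-irrefl refl i≤k

  Moves-functional : ∀ {x t i k k₁ k₂} → Moves x t i k k₁ → Moves x t i k k₂ → k₁ ≡ k₂
  Moves-functional (stays _)      (stays _)      = refl
  Moves-functional (stays k<i)    (joinsLeft _)  = ⊥-elim (<-irrefl refl k<i)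
  Moves-functional (stays k<i)    (joinsRight _) = ⊥-elim (<-irrefl refl k<i)
  Moves-functional (stays k<i)    (shifts i≤k)   = ⊥-elim (<-asym k<i (s≤s i≤k))
  Moves-functional (joinsLeft _)  (stays k<i)    = ⊥-elim (<-irrefl refl k<i)
  Moves-functional (joinsLeft _)  (joinsLeft _)  = refl
  Moves-functional (joinsLeft t<x) (joinsRight x<t) = ⊥-elim (<-asym t<x x<t)
  Moves-functional (joinsLeft _)  (shifts i≤k)   = ⊥-elim (<-irrefl refl i≤k)
  Moves-functional (joinsRight _) (stays k<i)    = ⊥-elim (<-irrefl refl k<i)
  Moves-functional (joinsRight x<t) (joinsLeft t<x) = ⊥-elim (<-asym t<x x<t)
  Moves-functional (joinsRight _) (joinsRight _) = refl
  Moves-functional (joinsRight _) (shifts i≤k)   = ⊥-elim (<-irrefl refl i≤k)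
  Moves-functional (shifts i≤k)   (stays k<i)    = ⊥-elim (<-asym k<i (s≤s i≤k))
  Moves-functional (shifts i≤k)   (joinsLeft _)  = ⊥-elim (<-irrefl refl i≤k)
  Moves-functional (shifts i≤k)   (joinsRight _) = ⊥-elim (<-irrefl refl i≤k)
  Moves-functional (shifts _)     (shifts _)     = refl

  Moves-ordered : ∀ {x s t i k₁ k₂ k₁′ k₂′} → Moves x s i k₁ k₁′ → Moves x t i k₂ k₂′ → k₁′ < k₂′ →
                  k₁ < k₂ ⊎ toℕ s < toℕ t
  Moves-ordered (stays _)      mv₂ k₁<k₂′ = inj₁ (<-≤-trans k₁<k₂′ (Moves-≤ mv₂))
  Moves-ordered (joinsRight _) mv₂ k₁<k₂′ = inj₁ (<-≤-trans k₁<k₂′ (Moves-≤ mv₂))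
  Moves-ordered (joinsLeft _)  (joinsLeft _)  lt = inj₁ (s≤s lt)
  Moves-ordered (joinsLeft _)  (shifts _)     lt = inj₁ (s≤s lt)
  Moves-ordered (shifts _)     (joinsLeft _)  lt = inj₁ (s≤s lt)
  Moves-ordered (shifts _)     (shifts _)     lt = inj₁ (s≤s lt)
  Moves-ordered (joinsLeft s<x) (joinsRight x<t) _ = inj₂ (<-trans s<x x<t)
  Moves-ordered (joinsLeft _)  (stays k<i)    lt = ⊥-elim (<⇒≱ lt (≤-pred k<i))
  Moves-ordered (shifts i≤k)   (stays k<i)    lt = ⊥-elim (<-asym lt (<-≤-trans k<i i≤k))
  Moves-ordered (shifts i≤k)   (joinsRight _) lt = ⊥-elim (<⇒≱ lt i≤k)

  ∈-mergedRight⁻ : ∀ {x t B C Bs} → t ∈ (B ∩ above x) ∪ C →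
                  ∃ λ k → InBlock t (B ∷ C ∷ Bs) k × Moves x t 0 k 0
  ∈-mergedRight⁻ {x} {t} {B} {C} t∈ with x∈p∪q⁻ (B ∩ above x) C t∈
  ... | inj₁ t∈B∩ = let t∈B , x<t = x∈p∩q⁻ B (above x) t∈B∩ in 0 , inHead t∈B , joinsRight (∈above⁻ x<t)
  ... | inj₂ t∈C  = 1 , inTail (inHead t∈C) , shifts z≤n

  ∈-mergedLeft⁻ : ∀ {x t P B Bs} → t ∈ P ∪ (B ∩ below x) →
                 ∃ λ k → InBlock t (P ∷ B ∷ Bs) k × Moves x t 1 k 0
  ∈-mergedLeft⁻ {x} {t} {P} {B} t∈ with x∈p∪q⁻ P (B ∩ below x) t∈
  ... | inj₁ t∈P  = 0 , inHead t∈P , stays (s≤s z≤n)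
  ... | inj₂ t∈B∩ = let t∈B , t<x = x∈p∩q⁻ B (below x) t∈B∩ in 1 , inTail (inHead t∈B) , joinsLeft (∈below⁻ t<x)

  delMid⇒ : ∀ x P Bs {i t k′} → InBlock x Bs i → blockIndex x Bs ≡ suc i → InBlock t (delMid x P Bs) k′ →
            ∃ λ k → InBlock t (P ∷ Bs) k × Moves x t (suc i) k k′
  delMid⇒ x P (B ∷ Bs) mx bx m with x ∈? B
  delMid⇒ x P (B ∷ []) mx refl (inHead t∈) | yes _ = ∈-mergedLeft⁻ t∈
  delMid⇒ x P (B ∷ C ∷ Bs) mx refl (inHead t∈) | yes _ = ∈-mergedLeft⁻ t∈
  delMid⇒ x P (B ∷ C ∷ Bs) mx refl (inTail (inHead t∈)) | yes _ =
    let k , m , mv = ∈-mergedRight⁻ t∈ in suc k , inTail m , Moves-suc mv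
  delMid⇒ x P (B ∷ C ∷ Bs) mx refl (inTail (inTail m)) | yes _ =
    _ , inTail (inTail (inTail m)) , shifts (s≤s z≤n)
  delMid⇒ x P (B ∷ Bs) (inHead x∈B) bx m | no x∉B = ⊥-elim (x∉B x∈B)
  delMid⇒ x P (B ∷ Bs) (inTail mx) bx (inHead t∈P) | no _ = 0 , inHead t∈P , stays (s≤s z≤n)
  delMid⇒ x P (B ∷ Bs) (inTail mx) bx (inTail m) | no _ =
    let k , m′ , mv = delMid⇒ x B Bs mx (suc-injective bx) m in suc k , inTail m′ , Moves-suc mv

  del⇒ : ∀ x D {i t k′} → InBlock x D i → blockIndex x D ≡ suc i → InBlock t (del x D) k′ →
         ∃ λ k → InBlock t D k × Moves x t i k k′
  del⇒ x (B ∷ Bs) mx bx m with x ∈? B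
  del⇒ x (B ∷ C ∷ Bs) mx refl (inHead t∈) | yes _ = ∈-mergedRight⁻ t∈
  del⇒ x (B ∷ C ∷ Bs) mx refl (inTail m) | yes _ = _ , inTail (inTail m) , shifts z≤n
  del⇒ x (B ∷ Bs) (inHead x∈B) bx m | no x∉B = ⊥-elim (x∉B x∈B)
  del⇒ x (B ∷ Bs) (inTail mx) bx m | no _ = delMid⇒ x B Bs mx (suc-injective bx) m

  delMid⇐ : ∀ x P Bs {i t k k′} → InBlock x Bs i → blockIndex x Bs ≡ suc i →
            (∀ {u} → InBlock u (P ∷ Bs) (suc i) → toℕ x < toℕ u → suc (suc i) < length (P ∷ Bs)) →
            InBlock t (P ∷ Bs) k → Moves x t (suc i) k k′ → InBlock t (delMid x P Bs) k′
  delMid⇐ x P (B ∷ Bs) mx bx notLast m mv with x ∈? B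
  delMid⇐ x P (B ∷ []) mx refl notLast (inHead t∈P) (stays _) | yes _ = inHead (x∈p∪q⁺ (inj₁ t∈P))
  delMid⇐ x P (B ∷ C ∷ Bs) mx refl notLast (inHead t∈P) (stays _) | yes _ = inHead (x∈p∪q⁺ (inj₁ t∈P))
  delMid⇐ x P (B ∷ Bs) mx refl notLast (inTail _) (stays (s≤s ())) | yes _
  delMid⇐ x P (B ∷ []) mx refl notLast (inTail (inHead _)) (shifts ()) | yes _
  delMid⇐ x P (B ∷ []) mx refl notLast (inTail (inTail ())) (shifts _) | yes _
  delMid⇐ x P (B ∷ []) mx refl notLast (inTail (inHead t∈B)) (joinsLeft t<x) | yes _ =
    inHead (x∈p∪q⁺ (inj₂ (x∈p∩q⁺ (t∈B , ∈below⁺ t<x))))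
  delMid⇐ x P (B ∷ C ∷ Bs) mx refl notLast (inTail (inHead t∈B)) (joinsLeft t<x) | yes _ =
    inHead (x∈p∪q⁺ (inj₂ (x∈p∩q⁺ (t∈B , ∈below⁺ t<x))))
  delMid⇐ x P (B ∷ []) mx refl notLast (inTail m) (joinsRight x<t) | yes _ with notLast (inTail m) x<t
  ... | s≤s (s≤s ())
  delMid⇐ x P (B ∷ C ∷ Bs) mx refl notLast (inTail (inHead t∈B)) (joinsRight x<t) | yes _ =
    inTail (inHead (x∈p∪q⁺ (inj₁ (x∈p∩q⁺ (t∈B , ∈above⁺ x<t)))))
  delMid⇐ x P (B ∷ C ∷ Bs) mx refl notLast (inTail (inTail (inHead t∈C))) (shifts _) | yes _ =
    inTail (inHead (x∈p∪q⁺ (inj₂ t∈C)))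
  delMid⇐ x P (B ∷ C ∷ Bs) mx refl notLast (inTail (inTail (inTail m))) (shifts _) | yes _ =
    inTail (inTail m)
  delMid⇐ x P (B ∷ Bs) (inHead x∈B) bx notLast m mv | no x∉B = ⊥-elim (x∉B x∈B)
  delMid⇐ x P (B ∷ Bs) (inTail mx) bx notLast (inHead t∈P) (stays _) | no _ = inHead t∈P
  delMid⇐ x P (B ∷ Bs) (inTail mx) bx notLast (inTail m) mv | no _ with Moves-pred mv
  ... | _ , refl , mv′ =
    inTail (delMid⇐ x B Bs mx (suc-injective bx) (λ mu x<u → ≤-pred (notLast (inTail mu) x<u)) m mv′)

  del⇐ : ∀ x D {i t k k′} → InBlock x D i → blockIndex x D ≡ suc i →
         (∀ {u} → InBlock u D i → toℕ x < toℕ u → suc i < length D) →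
         InBlock t D k → Moves x t i k k′ → InBlock t (del x D) k′
  del⇐ x (B ∷ Bs) mx bx notLast m mv with x ∈? B
  del⇐ x (B ∷ []) mx refl notLast m (joinsRight x<t) | yes _ with notLast m x<t
  ... | s≤s ()
  del⇐ x (B ∷ []) mx refl notLast (inTail ()) (shifts _) | yes _
  del⇐ x (B ∷ C ∷ Bs) mx refl notLast (inHead t∈B) (joinsRight x<t) | yes _ =
    inHead (x∈p∪q⁺ (inj₁ (x∈p∩q⁺ (t∈B , ∈above⁺ x<t))))
  del⇐ x (B ∷ C ∷ Bs) mx refl notLast (inTail (inHead t∈C)) (shifts _) | yes _ = inHead (x∈p∪q⁺ (inj₂ t∈C))
  del⇐ x (B ∷ C ∷ Bs) mx refl notLast (inTail (inTail m)) (shifts _) | yes _ = inTail m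
  del⇐ x (B ∷ Bs) (inHead x∈B) bx notLast m mv | no x∉B = ⊥-elim (x∉B x∈B)
  del⇐ x (B ∷ Bs) (inTail mx) bx notLast m mv | no _ = delMid⇐ x B Bs mx (suc-injective bx) notLast m mv

  length-delMid : ∀ x P Bs {i} → InBlock x Bs i → length (delMid x P Bs) ≡ length Bs
  length-delMid x P (B ∷ Bs) mx with x ∈? B
  length-delMid x P (B ∷ []) mx | yes _ = refl
  length-delMid x P (B ∷ C ∷ Bs) mx | yes _ = refl
  length-delMid x P (B ∷ Bs) (inHead x∈B) | no x∉B = ⊥-elim (x∉B x∈B)
  length-delMid x P (B ∷ Bs) (inTail mx) | no _ = cong suc (length-delMid x B Bs mx)

  length-del : ∀ x D {i} → InBlock x D i → suc (length (del x D)) ≡ length D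
  length-del x (B ∷ Bs) mx with x ∈? B
  length-del x (B ∷ []) mx | yes _ = refl
  length-del x (B ∷ C ∷ Bs) mx | yes _ = refl
  length-del x (B ∷ Bs) (inHead x∈B) | no x∉B = ⊥-elim (x∉B x∈B)
  length-del x (B ∷ Bs) (inTail mx) | no _ = cong suc (length-delMid x B Bs mx)

  Ordered : List (Subset n) → Set
  Ordered D = ∀ {s t k l} → k < l → InBlock s D k → InBlock t D l → toℕ s < toℕ t

  -- As for a division of an n-set into n blocks, there are as many blocks as elements;
  -- a deletion removes one of each.
  record Valid (D : List (Subset n)) : Set where
    field
      disjoint : Disjoint D
      ordered  : Ordered D
      balanced : ∣ ⋃ D ∣ ≡ length D
  open Valid public

  Valid⇒≤-block : ∀ {D} → Valid D → ∀ {s t k l} → InBlock s D k → InBlock t D l → toℕ s < toℕ t → k ≤ l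
  Valid⇒≤-block v {k = k} {l} ms mt s<t with k ≤? l
  ... | yes k≤l = k≤l
  ... | no k≰l = ⊥-elim (<-asym s<t (ordered v (≰⇒> k≰l) mt ms))

  Valid⇒singleton : ∀ {D} → Valid D → length D ≡ 1 → ∀ {s t k l} → InBlock s D k → InBlock t D l → s ≡ t
  Valid⇒singleton {D} v len≡1 {s} {t} ms mt with s F.≟ t
  ... | yes s≡t = s≡t
  ... | no s≢t = ⊥-elim (<-irrefl (sym (trans (balanced v) len≡1))
                          (∈-distinct⇒1<∣p∣ (InBlock⇒∈⋃ ms) (InBlock⇒∈⋃ mt) s≢t))

  data AdmissibleAt (D : List (Subset n)) (x : Fin n) : ℕ → Set where
    leastOfFirst   : InBlock x D 0 → (∀ {t} → InBlock t D 0 → toℕ x ≤ toℕ t) → AdmissibleAt D x 0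
    greatestOfLast : ∀ {i} → InBlock x D i → suc i ≡ length D → (∀ {t} → InBlock t D i → toℕ t ≤ toℕ x) →
                     AdmissibleAt D x i
    interior       : ∀ {i} → InBlock x D (suc i) → suc (suc i) < length D → AdmissibleAt D x (suc i)

  AdmissibleAt⇒InBlock : ∀ {D x i} → AdmissibleAt D x i → InBlock x D i
  AdmissibleAt⇒InBlock (leastOfFirst mx _)     = mx
  AdmissibleAt⇒InBlock (greatestOfLast mx _ _) = mx
  AdmissibleAt⇒InBlock (interior mx _)         = mx

  ∈lookup⇒InBlock : ∀ {t : Fin n} D (k : Fin (length D)) → t ∈ lookup D k → InBlock t D (toℕ k)
  ∈lookup⇒InBlock (B ∷ Bs) zero    t∈ = inHead t∈
  ∈lookup⇒InBlock (B ∷ Bs) (suc k) t∈ = inTail (∈lookup⇒InBlock Bs k t∈)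

  InBlock⇒∈lookup : ∀ {t : Fin n} D (k : Fin (length D)) → InBlock t D (toℕ k) → t ∈ lookup D k
  InBlock⇒∈lookup (B ∷ Bs) zero    (inHead t∈) = t∈
  InBlock⇒∈lookup (B ∷ Bs) (suc k) (inTail m)  = InBlock⇒∈lookup Bs k m

  Admissible⇒AdmissibleAt : ∀ {D : List (Subset n)} {x} → Admissible D x → ∃ (AdmissibleAt D x)
  Admissible⇒AdmissibleAt {B ∷ Bs} (inj₁ (zero , _ , x∈ , least)) =
    0 , leastOfFirst (inHead x∈) λ { (inHead t∈) → least _ t∈ }
  Admissible⇒AdmissibleAt {D} (inj₂ (inj₁ (k , last , x∈ , greatest))) =
    toℕ k , greatestOfLast (∈lookup⇒InBlock D k x∈) last (greatest _ ∘ InBlock⇒∈lookup D k)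
  Admissible⇒AdmissibleAt {B ∷ Bs} (inj₂ (inj₂ (zero , k≢0 , _ , _))) = ⊥-elim (k≢0 refl)
  Admissible⇒AdmissibleAt {D@(_ ∷ _)} (inj₂ (inj₂ (suc k , _ , k≢last , x∈))) =
    suc (toℕ k) , interior (∈lookup⇒InBlock D (suc k) x∈) (≤∧≢⇒< (toℕ<n (suc k)) k≢last)

  AdmissibleAt⇒Admissible : ∀ {D : List (Subset n)} {x i} → AdmissibleAt D x i → Admissible D x
  AdmissibleAt⇒Admissible (leastOfFirst (inHead x∈) least) =
    inj₁ (zero , refl , x∈ , λ _ t∈ → least (inHead t∈))
  AdmissibleAt⇒Admissible {D} {x} {i} (greatestOfLast mx last greatest) =
    inj₂ (inj₁ (k , trans (cong suc k≡i) last , InBlock⇒∈lookup D k (subst (InBlock x D) (sym k≡i) mx) ,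
                λ _ t∈ → greatest (subst (InBlock _ D) k≡i (∈lookup⇒InBlock D k t∈))))
    where
      k : Fin (length D)
      k = fromℕ< (InBlock⇒<length mx)
      k≡i : toℕ k ≡ _
      k≡i = toℕ-fromℕ< (InBlock⇒<length mx)
  AdmissibleAt⇒Admissible {D} {x} {suc i} (interior mx notLast) =
    inj₂ (inj₂ (k , (λ k≡0 → 0≢1+n (trans (sym k≡0) k≡i)) ,
                (λ k≡last → <-irrefl (trans (sym (cong suc k≡i)) k≡last) notLast) ,
                InBlock⇒∈lookup D k (subst (InBlock x D) (sym k≡i) mx)))
    where
      k : Fin (length D)
      k = fromℕ< (InBlock⇒<length mx)
      k≡i : toℕ k ≡ _
      k≡i = toℕ-fromℕ< (InBlock⇒<length mx)

  above⇒notLast : ∀ {D} → Valid D → ∀ {x i} → AdmissibleAt D x i →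
                  ∀ {t} → InBlock t D i → toℕ x < toℕ t → suc i < length D
  above⇒notLast v adm mt x<t with m≤n⇒m<n∨m≡n (InBlock⇒<length (AdmissibleAt⇒InBlock adm)) | adm
  ... | inj₁ i+1<len | _ = i+1<len
  ... | inj₂ len≡1 | leastOfFirst mx _ = ⊥-elim (<-irrefl (cong toℕ (Valid⇒singleton v (sym len≡1) mx mt)) x<t)
  ... | inj₂ _ | greatestOfLast _ _ t≤x = ⊥-elim (<⇒≱ x<t (t≤x mt))
  ... | inj₂ i+1≡len | interior _ i+2<len = ⊥-elim (<-irrefl i+1≡len i+2<len)

  below⇒notFirst : ∀ {D} → Valid D → ∀ {x i} → AdmissibleAt D x i →
                   ∀ {t} → InBlock t D i → toℕ t < toℕ x → ∃ λ j → i ≡ suc j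
  below⇒notFirst v (leastOfFirst _ x≤t) mt t<x = ⊥-elim (<⇒≱ t<x (x≤t mt))
  below⇒notFirst v (interior _ _) mt t<x = _ , refl
  below⇒notFirst v (greatestOfLast {zero} mx len≡1 _) mt t<x =
    ⊥-elim (<-irrefl (cong toℕ (Valid⇒singleton v (sym len≡1) mt mx)) t<x)
  below⇒notFirst v (greatestOfLast {suc j} _ _ _) mt t<x = j , refl

  Moves-exists : ∀ {D} → Valid D → ∀ {x i} → AdmissibleAt D x i →
                 ∀ {t k} → t ≢ x → InBlock t D k → ∃ (Moves x t i k)
  Moves-exists v {i = i} adm {k = k} t≢x mt with <-cmp k i
  ... | tri< k<i _ _ = k , stays k<i
  Moves-exists v adm {k = suc k₀} t≢x mt | tri> _ _ i<k = k₀ , shifts (≤-pred i<k)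
  Moves-exists v {x} adm {t} t≢x mt | tri≈ _ refl _ with <-cmp (toℕ t) (toℕ x)
  ... | tri≈ _ t≡x _ = ⊥-elim (t≢x (toℕ-injective t≡x))
  ... | tri> _ _ x<t = _ , joinsRight x<t
  ... | tri< t<x _ _ with below⇒notFirst v adm mt t<x
  ... | j , refl = j , joinsLeft t<x

  rank : Subset n → Fin n → ℕ
  rank p t = ∣ p ∩ below t ∣

  RankBounded : List (Subset n) → Set
  RankBounded D = ∀ {t k} → InBlock t D k → k ≤ rank (⋃ D) t

  ∈∩below⁻ : ∀ p {u t : Fin n} → u ∈ p ∩ below t → u ∈ p × toℕ u < toℕ t
  ∈∩below⁻ p {t = t} u∈ = let u∈p , u<t = x∈p∩q⁻ p (below t) u∈ in u∈p , ∈below⁻ u<t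

  ∈∩below⁺ : ∀ {p} {u t : Fin n} → u ∈ p → toℕ u < toℕ t → u ∈ p ∩ below t
  ∈∩below⁺ u∈p u<t = x∈p∩q⁺ (u∈p , ∈below⁺ u<t)

  ∉below-self : ∀ p {t : Fin n} → t ∉ p ∩ below t
  ∉below-self p t∈ = <-irrefl refl (proj₂ (∈∩below⁻ p t∈))

  rank-<-mono : ∀ {p} {s t : Fin n} → s ∈ p → toℕ s < toℕ t → rank p s < rank p t
  rank-<-mono {p} {s} {t} s∈p s<t = p⊂q⇒∣p∣<∣q∣ {p = p ∩ below s} {p ∩ below t}
    ( (λ u∈ → let u∈p , u<s = ∈∩below⁻ p u∈ in ∈∩below⁺ {t = t} u∈p (<-trans u<s s<t))
    , s , ∈∩below⁺ {t = t} s∈p s<t , ∉below-self p)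

  rank<∣p∣ : ∀ {p} {t : Fin n} → t ∈ p → rank p t < ∣ p ∣
  rank<∣p∣ {p} {t} t∈p = p⊂q⇒∣p∣<∣q∣ {p = p ∩ below t} ((proj₁ ∘ ∈∩below⁻ p {t = t}) , t , t∈p , ∉below-self p)

  rank-⊆ : ∀ {p q} {t : Fin n} → q ⊆ p → rank q t ≤ rank p t
  rank-⊆ {p} {q} {t} q⊆p = p⊆q⇒∣p∣≤∣q∣ {p = q ∩ below t} {p ∩ below t}
    λ u∈ → let u∈q , u<t = ∈∩below⁻ q u∈ in ∈∩below⁺ {t = t} (q⊆p u∈q) u<t

  rank-least : ∀ p {t : Fin n} → (∀ {u} → u ∈ p → toℕ t ≤ toℕ u) → rank p t ≡ 0
  rank-least p {t} least = trans (cong ∣_∣ (Empty-unique {p = p ∩ below t} λ (u , u∈) →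
    let u∈p , u<t = ∈∩below⁻ p u∈ in <⇒≱ u<t (least u∈p))) (∣⊥∣≡0 n)

  rank-successor : ∀ {p} {x y : Fin n} → x ∈ p → toℕ x < toℕ y →
                   (∀ {u} → u ∈ p → toℕ x < toℕ u → toℕ y ≤ toℕ u) → rank p y ≡ suc (rank p x)
  rank-successor {p} {x} {y} x∈p x<y next =
    ∣p∣≡1+∣q∣ {p = p ∩ below y} {p ∩ below x} x (∈∩below⁺ x∈p x<y) (∉below-self p)
    (λ u∈ → let u∈p , u<x = ∈∩below⁻ p u∈ in ∈∩below⁺ {t = y} u∈p (<-trans u<x x<y))
    (λ u∈ u≢x → let u∈p , u<y = ∈∩below⁻ p u∈ in ∈∩below⁺ {t = x} u∈p (between u∈p u<y u≢x))
    where
      between : ∀ {u} → u ∈ p → toℕ u < toℕ y → u ≢ x → toℕ u < toℕ x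
      between {u} u∈p u<y u≢x with <-cmp (toℕ u) (toℕ x)
      ... | tri< u<x _ _ = u<x
      ... | tri≈ _ u≡x _ = ⊥-elim (u≢x (toℕ-injective u≡x))
      ... | tri> _ _ x<u = ⊥-elim (<⇒≱ u<y (next u∈p x<u))

  ∣p∣≡1+rank : ∀ {p : Subset n} {x} → x ∈ p → (∀ {u} → u ∈ p → toℕ u ≤ toℕ x) → ∣ p ∣ ≡ suc (rank p x)
  ∣p∣≡1+rank {p} {x} x∈p maximal = ∣p∣≡1+∣q∣ {p = p} {p ∩ below x} x x∈p (∉below-self p) (proj₁ ∘ ∈∩below⁻ p {t = x})
    λ {u} u∈p u≢x → ∈∩below⁺ {t = x} u∈p (≤∧≢⇒< (maximal u∈p) (u≢x ∘ toℕ-injective))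

  module Deletion {D : List (Subset n)} (v : Valid D) {x : Fin n} {i : ℕ} (adm : AdmissibleAt D x i) where

    D′ : List (Subset n)
    D′ = del x D

    mx : InBlock x D i
    mx = AdmissibleAt⇒InBlock adm

    blockIndex-x : blockIndex x D ≡ suc i
    blockIndex-x = blockIndex-InBlock (disjoint v) mx

    survives : ∀ {t k} → t ≢ x → InBlock t D k → ∃ λ k′ → InBlock t D′ k′ × Moves x t i k k′
    survives t≢x mt = let k′ , mv = Moves-exists v adm t≢x mt in
      k′ , del⇐ x D mx blockIndex-x (above⇒notLast v adm) mt mv , mv

    origin : ∀ {t k′} → InBlock t D′ k′ → t ≢ x × ∃ λ k → InBlock t D k × Moves x t i k k′
    origin mt′ with del⇒ x D mx blockIndex-x mt′
    ... | k , mt , mv = (λ { refl → Moves-irrefl (subst (λ k → Moves x x i k _) (disjoint v mt mx) mv) }) , k , mt , mv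

    ∈⋃D′⁻ : ∀ {t} → t ∈ ⋃ D′ → t ∈ ⋃ D × t ≢ x
    ∈⋃D′⁻ {t} t∈ = let k′ , mt′ = ∈⋃⇒InBlock D′ t∈ ; t≢x , _ , mt , _ = origin mt′ in InBlock⇒∈⋃ mt , t≢x

    ∈⋃D′⁺ : ∀ {t} → t ∈ ⋃ D → t ≢ x → t ∈ ⋃ D′
    ∈⋃D′⁺ {t} t∈ t≢x = let k , mt = ∈⋃⇒InBlock D t∈ ; _ , mt′ , _ = survives t≢x mt in InBlock⇒∈⋃ mt′

    ∣⋃D∣≡1+∣⋃D′∣ : ∣ ⋃ D ∣ ≡ suc ∣ ⋃ D′ ∣
    ∣⋃D∣≡1+∣⋃D′∣ = ∣p∣≡1+∣q∣ x (InBlock⇒∈⋃ mx) (λ x∈ → proj₂ (∈⋃D′⁻ x∈) refl) (proj₁ ∘ ∈⋃D′⁻) ∈⋃D′⁺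

    valid : Valid D′
    valid = record { disjoint = disjoint′ ; ordered = ordered′ ; balanced = balanced′ }
      where
        disjoint′ : Disjoint D′
        disjoint′ mt₁ mt₂ with origin mt₁ | origin mt₂
        ... | _ , _ , n₁ , mv₁ | _ , _ , n₂ , mv₂ rewrite disjoint v n₁ n₂ = Moves-functional mv₁ mv₂
        ordered′ : Ordered D′
        ordered′ k<l ms mt with origin ms | origin mt
        ... | _ , _ , n₁ , mv₁ | _ , _ , n₂ , mv₂ with Moves-ordered mv₁ mv₂ k<l
        ... | inj₁ j₁<j₂ = ordered v j₁<j₂ n₁ n₂
        ... | inj₂ s<t = s<t
        balanced′ : ∣ ⋃ D′ ∣ ≡ length D′
        balanced′ = suc-injective (begin
          suc ∣ ⋃ D′ ∣      ≡⟨ sym ∣⋃D∣≡1+∣⋃D′∣ ⟩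
          ∣ ⋃ D ∣           ≡⟨ balanced v ⟩
          length D          ≡⟨ sym (length-del x D mx) ⟩
          suc (length D′)   ∎)
          where open ≡-Reasoning

    rank-below : ∀ {t} → toℕ t < toℕ x → rank (⋃ D′) t ≡ rank (⋃ D) t
    rank-below {t} t<x = cong ∣_∣ (⊆-antisym
      (λ u∈ → let u∈D′ , u<t = ∈∩below⁻ (⋃ D′) u∈ in ∈∩below⁺ {t = t} (proj₁ (∈⋃D′⁻ u∈D′)) u<t)
      (λ u∈ → let u∈D , u<t = ∈∩below⁻ (⋃ D) u∈ in
        ∈∩below⁺ {t = t} (∈⋃D′⁺ u∈D (λ { refl → <-asym u<t t<x })) u<t))

    rank-above : ∀ {t} → toℕ x < toℕ t → rank (⋃ D) t ≡ suc (rank (⋃ D′) t)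
    rank-above {t} x<t = ∣p∣≡1+∣q∣ {p = ⋃ D ∩ below t} {⋃ D′ ∩ below t} x
      (∈∩below⁺ {t = t} (InBlock⇒∈⋃ mx) x<t) (λ x∈ → proj₂ (∈⋃D′⁻ (proj₁ (∈∩below⁻ (⋃ D′) {t = t} x∈))) refl)
      (λ u∈ → let u∈D′ , u<t = ∈∩below⁻ (⋃ D′) u∈ in ∈∩below⁺ {t = t} (proj₁ (∈⋃D′⁻ u∈D′)) u<t)
      (λ u∈ u≢x → let u∈D , u<t = ∈∩below⁻ (⋃ D) u∈ in ∈∩below⁺ {t = t} (∈⋃D′⁺ u∈D u≢x) u<t)

    rankBounded : RankBounded D → RankBounded D′
    rankBounded bounded {t} {k′} mt′ with origin mt′
    ... | t≢x , k , mt , mv with <-cmp (toℕ t) (toℕ x)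
    ... | tri≈ _ t≡x _ = ⊥-elim (t≢x (toℕ-injective t≡x))
    ... | tri< t<x _ _ = ≤-trans (Moves-≤ mv) (subst (k ≤_) (sym (rank-below t<x)) (bounded mt))
    ... | tri> _ _ x<t with mv
    ... | stays k<i = ⊥-elim (<-asym x<t (ordered v k<i mt mx))
    ... | joinsRight _ = ≤-pred (begin
      suc i             ≤⟨ s≤s (bounded mx) ⟩
      suc (rank (⋃ D) x) ≤⟨ rank-<-mono (InBlock⇒∈⋃ mx) x<t ⟩
      rank (⋃ D) t      ≡⟨ rank-above x<t ⟩
      suc (rank (⋃ D′) t) ∎)
      where open ≤-Reasoning
    ... | joinsLeft t<x = ⊥-elim (<-asym t<x x<t)
    ... | shifts _ = ≤-pred (subst (k ≤_) (rank-above x<t) (bounded mt))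

  -- Index functions of admissible sequences

  data AdmissibleSeq : List (Subset n) → List (Fin n) → Set where
    []  : ∀ {D : List (Subset n)} → AdmissibleSeq D []
    _∷_ : ∀ {D x i xs} → AdmissibleAt D x i → AdmissibleSeq (del x D) xs → AdmissibleSeq D (x ∷ xs)

  AdmissibleSeq⁺ : ∀ D (w : List (Fin n)) →
                   (∀ (k : Fin (length w)) → Admissible (delAll D (take (toℕ k) w)) (lookup w k)) → AdmissibleSeq D w
  AdmissibleSeq⁺ D []       adm = []
  AdmissibleSeq⁺ D (x ∷ xs) adm = proj₂ (Admissible⇒AdmissibleAt (adm zero)) ∷ AdmissibleSeq⁺ (del x D) xs (adm ∘ suc)

  AdmissibleSeq⁻ : ∀ {D} {w : List (Fin n)} → AdmissibleSeq D w →
                   ∀ (k : Fin (length w)) → Admissible (delAll D (take (toℕ k) w)) (lookup w k)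
  AdmissibleSeq⁻ (adm ∷ _)    zero    = AdmissibleAt⇒Admissible adm
  AdmissibleSeq⁻ (_ ∷ admSeq) (suc k) = AdmissibleSeq⁻ admSeq k

  assoc-here : ∀ (x : Fin n) k l → assoc x ((x , k) ∷ l) ≡ k
  assoc-here x k l with x F.≟ x
  ... | yes _   = refl
  ... | no x≢x = ⊥-elim (x≢x refl)

  assoc-there : ∀ {t x : Fin n} k l → t ≢ x → assoc t ((x , k) ∷ l) ≡ assoc t l
  assoc-there {t} {x} k l t≢x with t F.≟ x
  ... | yes t≡x = ⊥-elim (t≢x t≡x)
  ... | no _    = refl

  assoc-∉ : ∀ {D} {t : Fin n} {w} → ¬ t ∈ₗ w → assoc t (indices D w) ≡ 0
  assoc-∉ {w = []}     t∉ = refl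
  assoc-∉ {w = x ∷ xs} t∉ = trans (assoc-there _ _ (t∉ ∘ here)) (assoc-∉ (t∉ ∘ there))

  AdmissibleSeq⇒∈⋃ : ∀ {D : List (Subset n)} → Valid D → ∀ {w} → AdmissibleSeq D w → ∀ {t} → t ∈ₗ w → t ∈ ⋃ D
  AdmissibleSeq⇒∈⋃ v (adm ∷ _)      (here refl) = InBlock⇒∈⋃ (AdmissibleAt⇒InBlock adm)
  AdmissibleSeq⇒∈⋃ v (adm ∷ admSeq) (there t∈)  = proj₁ (∈⋃D′⁻ (AdmissibleSeq⇒∈⋃ valid admSeq t∈))
    where open Deletion v adm

  AdmissibleSeq⇒Unique : ∀ {D : List (Subset n)} → Valid D → ∀ {w} → AdmissibleSeq D w → Unique w
  AdmissibleSeq⇒Unique v []             = []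
  AdmissibleSeq⇒Unique v (adm ∷ admSeq) =
    All-tabulate (λ t∈ x≡t → proj₂ (∈⋃D′⁻ (AdmissibleSeq⇒∈⋃ valid admSeq t∈)) (sym x≡t))
    ∷ AdmissibleSeq⇒Unique valid admSeq
    where open Deletion v adm

  index-within-block : ∀ {D : List (Subset n)} → Valid D → ∀ {w} → AdmissibleSeq D w → ∀ {t k} → t ∈ₗ w → InBlock t D k →
                       1 ≤ assoc t (indices D w) × assoc t (indices D w) ≤ suc k
  index-within-block {D} v {x ∷ xs} (adm ∷ admSeq) {t} {k} t∈ mt with t F.≟ x
  ... | yes refl = subst (λ a → 1 ≤ a × a ≤ suc k) (sym (blockIndex-InBlock (disjoint v) mt)) (s≤s z≤n , ≤-refl)
  ... | no t≢x with t∈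
  ...   | here t≡x = ⊥-elim (t≢x t≡x)
  ...   | there t∈xs =
    let _ , mt′ , mv = survives t≢x mt
        pos , bound = index-within-block valid admSeq t∈xs mt′
    in pos , ≤-trans bound (s≤s (Moves-≤ mv))
    where open Deletion v adm

  moves-down : ∀ {D : List (Subset n)} → Valid D → ∀ {x i} → AdmissibleAt D x i → ∀ {y j} → InBlock y D j → y ≢ x →
               i < j ⊎ (j ≡ i × toℕ y < toℕ x) → ∃ λ j′ → InBlock y (del x D) j′ × j′ < j
  moves-down v adm my y≢x position with Deletion.survives v adm y≢x my | position
  ... | _ , my′ , stays j<i      | inj₁ i<j         = ⊥-elim (<-asym i<j j<i)
  ... | _ , my′ , stays j<i      | inj₂ (refl , _)  = ⊥-elim (<-irrefl refl j<i)
  ... | _ , my′ , joinsLeft _    | _                = _ , my′ , ≤-refl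
  ... | _ , my′ , joinsRight _   | inj₁ i<i         = ⊥-elim (<-irrefl refl i<i)
  ... | _ , my′ , joinsRight x<y | inj₂ (_ , y<x)   = ⊥-elim (<-asym x<y y<x)
  ... | _ , my′ , shifts _       | _                = _ , my′ , ≤-refl

  one-moves-down : ∀ {D : List (Subset n)} → Valid D → ∀ {x y i j} → AdmissibleAt D x i → AdmissibleAt D y j → x ≢ y →
                   (∃ λ j′ → InBlock y (del x D) j′ × j′ < j) ⊎ (∃ λ i′ → InBlock x (del y D) i′ × i′ < i)
  one-moves-down v {x} {y} {i} {j} admx admy x≢y with <-cmp i j
  ... | tri< i<j _ _ = inj₁ (moves-down v admx (AdmissibleAt⇒InBlock admy) (x≢y ∘ sym) (inj₁ i<j))
  ... | tri> _ _ j<i = inj₂ (moves-down v admy (AdmissibleAt⇒InBlock admx) x≢y (inj₁ j<i))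
  ... | tri≈ _ refl _ with <-cmp (toℕ x) (toℕ y)
  ...   | tri< x<y _ _ = inj₂ (moves-down v admy (AdmissibleAt⇒InBlock admx) x≢y (inj₂ (refl , x<y)))
  ...   | tri≈ _ x≡y _ = ⊥-elim (x≢y (toℕ-injective x≡y))
  ...   | tri> _ _ y<x = inj₁ (moves-down v admx (AdmissibleAt⇒InBlock admy) (x≢y ∘ sym) (inj₂ (refl , y<x)))

  Covers : List (Fin n) → Subset n → Set
  Covers w p = ∀ {t} → t ∈ p → t ∈ₗ w

  Covers-del : ∀ {D : List (Subset n)} → Valid D → ∀ {x i} → (adm : AdmissibleAt D x i) → ∀ {xs} →
               Covers (x ∷ xs) (⋃ D) → Covers xs (⋃ (del x D))
  Covers-del v adm cover t∈ with Deletion.∈⋃D′⁻ v adm t∈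
  ... | t∈D , t≢x with cover t∈D
  ...   | here t≡x  = ⊥-elim (t≢x t≡x)
  ...   | there t∈xs = t∈xs

  index-after-moving-down : ∀ {D : List (Subset n)} → Valid D → ∀ {x i xs} → (adm : AdmissibleAt D x i) →
                            AdmissibleSeq (del x D) xs → Covers (x ∷ xs) (⋃ D) → ∀ {y j} → y ≢ x → InBlock y D j →
                            (∃ λ j′ → InBlock y (del x D) j′ × j′ < j) → assoc y (indices D (x ∷ xs)) ≤ j
  index-after-moving-down v adm admSeq cover y≢x my (j′ , my′ , j′<j) =
    subst (_≤ _) (sym (assoc-there _ _ y≢x))
      (≤-trans (proj₂ (index-within-block (Deletion.valid v adm) admSeq (Covers-del v adm cover (InBlock⇒∈⋃ my′)) my′))
               j′<j)

  distinct-heads⇒indices-differ : ∀ {D : List (Subset n)} → Valid D → ∀ {x x′ i i′ xs xs′} → AdmissibleAt D x i → AdmissibleAt D x′ i′ →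
                   AdmissibleSeq (del x D) xs → AdmissibleSeq (del x′ D) xs′ →
                   Covers (x ∷ xs) (⋃ D) → Covers (x′ ∷ xs′) (⋃ D) → x ≢ x′ →
                   assoc x (indices D (x ∷ xs)) ≡ assoc x (indices D (x′ ∷ xs′)) →
                   assoc x′ (indices D (x ∷ xs)) ≡ assoc x′ (indices D (x′ ∷ xs′)) → ⊥
  distinct-heads⇒indices-differ {D} v {x} {x′} {i} {i′} {xs} {xs′} adm adm′ admSeq admSeq′ cover cover′ x≢x′ same-x same-x′ =
    [ (λ moved → 1+n≰n (subst (_≤ i′) x′-index (index-after-moving-down v adm admSeq cover (x≢x′ ∘ sym) mx′ moved)))
    , (λ moved → 1+n≰n (subst (_≤ i) x-index (index-after-moving-down v adm′ admSeq′ cover′ x≢x′ mx moved)))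
    ]′ (one-moves-down v adm adm′ x≢x′)
    where
      mx : InBlock x D i
      mx = AdmissibleAt⇒InBlock adm
      mx′ : InBlock x′ D i′
      mx′ = AdmissibleAt⇒InBlock adm′
      x-index : assoc x (indices D (x′ ∷ xs′)) ≡ suc i
      x-index = trans (sym same-x) (trans (assoc-here x _ _) (blockIndex-InBlock (disjoint v) mx))
      x′-index : assoc x′ (indices D (x ∷ xs)) ≡ suc i′
      x′-index = trans same-x′ (trans (assoc-here x′ _ _) (blockIndex-InBlock (disjoint v) mx′))

  AdmissibleSeq-injective : ∀ {D : List (Subset n)} → Valid D → ∀ {w w′} → AdmissibleSeq D w → AdmissibleSeq D w′ →
                            Covers w (⋃ D) → Covers w′ (⋃ D) →
                            (∀ t → assoc t (indices D w) ≡ assoc t (indices D w′)) → w ≡ w′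
  AdmissibleSeq-injective v [] [] _ _ _ = refl
  AdmissibleSeq-injective v [] (adm′ ∷ _) cover _ _ with cover (InBlock⇒∈⋃ (AdmissibleAt⇒InBlock adm′))
  ... | ()
  AdmissibleSeq-injective v (adm ∷ _) [] _ cover′ _ with cover′ (InBlock⇒∈⋃ (AdmissibleAt⇒InBlock adm))
  ... | ()
  AdmissibleSeq-injective {D} v {x ∷ xs} {x′ ∷ xs′} (adm ∷ admSeq) (adm′ ∷ admSeq′) cover cover′ same
    with x F.≟ x′
  ... | yes refl = cong (x ∷_) (AdmissibleSeq-injective valid admSeq admSeq′
                     (Covers-del v adm cover) (Covers-del v adm′ cover′) same-tail)
    where
      open Deletion v adm
      x∉ : ∀ {ys} → AdmissibleSeq D′ ys → ¬ x ∈ₗ ys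
      x∉ admSeq x∈ = proj₂ (∈⋃D′⁻ (AdmissibleSeq⇒∈⋃ valid admSeq x∈)) refl
      same-tail : ∀ t → assoc t (indices D′ xs) ≡ assoc t (indices D′ xs′)
      same-tail t with t F.≟ x
      ... | yes refl = trans (assoc-∉ (x∉ admSeq)) (sym (assoc-∉ (x∉ admSeq′)))
      ... | no t≢x = trans (sym (assoc-there _ _ t≢x)) (trans (same t) (assoc-there _ _ t≢x))
  ... | no x≢x′ = ⊥-elim (distinct-heads⇒indices-differ v adm adm′ admSeq admSeq′ cover cover′ x≢x′ (same x) (same x′))

  -- Realising an index function

  IndexBounded : List (Subset n) → (Fin n → ℕ) → Set
  IndexBounded D I = ∀ {t k} → InBlock t D k → 1 ≤ I t × I t ≤ suc k

  Tight : List (Subset n) → (Fin n → ℕ) → Fin n → Set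
  Tight D I t = t ∈ ⋃ D × I t ≡ blockIndex t D

  tight? : ∀ D I → Decidable (Tight D I)
  tight? D I t = (t ∈? ⋃ D) ×-dec (I t ℕ.≟ blockIndex t D)

  Tight⁻ : ∀ {D : List (Subset n)} → Valid D → ∀ I {t} → Tight D I t → ∃ λ k → InBlock t D k × I t ≡ suc k
  Tight⁻ {D} v I (t∈ , tight) = let k , mt = ∈⋃⇒InBlock D t∈ in k , mt , trans tight (blockIndex-InBlock (disjoint v) mt)

  Tight⁺ : ∀ {D : List (Subset n)} → Valid D → ∀ I {t k} → InBlock t D k → I t ≡ suc k → Tight D I t
  Tight⁺ v I mt It≡ = InBlock⇒∈⋃ mt , trans It≡ (sym (blockIndex-InBlock (disjoint v) mt))

  Dominates : List (Subset n) → (Fin n → ℕ) → Fin n → ℕ → Set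
  Dominates D I s i = ∀ {t k} → InBlock t D k → I t ≡ suc k → k ≤ i × (k ≡ i → toℕ s ≤ toℕ t)

  -- The least element has rank 0, so it lies in block 0, where an index can only be 1.
  least-is-tight : ∀ {D : List (Subset n)} → Valid D → RankBounded D → ∀ I → IndexBounded D I →
                   0 < length D → ∃ (Tight D I)
  least-is-tight {D} v bounded I ib 0<len
    with least (_∈? ⋃ D) (0<∣p∣⇒Nonempty (subst (0 <_) (sym (balanced v)) 0<len))
  ... | t₀ , t₀∈ , minimal with ∈⋃⇒InBlock D t₀∈
  ... | k₀ , mt₀ with n≤0⇒n≡0 (subst (k₀ ≤_) (rank-least (⋃ D) minimal) (bounded mt₀))
  ... | refl = t₀ , Tight⁺ v I mt₀ (≤-antisym (proj₂ (ib mt₀)) (proj₁ (ib mt₀)))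

  dominating-tight : ∀ {D : List (Subset n)} → Valid D → RankBounded D → ∀ I → IndexBounded D I →
                     0 < length D → ∃₂ λ s i → InBlock s D i × I s ≡ suc i × Dominates D I s i
  dominating-tight {D} v bounded I ib 0<len
    with greatest (tight? D I) (least-is-tight v bounded I ib 0<len)
  ... | x , x-tight , maximal with Tight⁻ v I x-tight
  ... | i , mx , _
    with least (λ t → tight? D I t ×-dec (blockIndex t D ℕ.≟ suc i)) (x , x-tight , blockIndex-InBlock (disjoint v) mx)
  ... | s , (s-tight , s-in-i) , minimal with Tight⁻ v I s-tight
  ... | i′ , ms , Is≡ with trans (sym (blockIndex-InBlock (disjoint v) ms)) s-in-i
  ... | refl = s , i , ms , Is≡ , dominates
    where
      dominates : Dominates D I s i
      dominates {t} {k} mt It≡ with m≤n⇒m<n∨m≡n (maximal (Tight⁺ v I mt It≡))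
      ... | inj₁ t<x = Valid⇒≤-block v mt mx t<x ,
                       λ { refl → minimal (Tight⁺ v I mt It≡ , blockIndex-InBlock (disjoint v) mt) }
      ... | inj₂ t≡x rewrite toℕ-injective t≡x | disjoint v mt mx =
        ≤-refl , λ _ → minimal (Tight⁺ v I mx It≡ , blockIndex-InBlock (disjoint v) mx)

  dominating-admissible : ∀ {D : List (Subset n)} → Valid D → RankBounded D → ∀ I → IndexBounded D I →
                          ∀ {s i} → InBlock s D i → Dominates D I s i → AdmissibleAt D s i
  dominating-admissible {D} v bounded I ib {s} {i} ms dominates with i ℕ.≟ 0 | suc i ℕ.≟ length D
  ... | yes refl | _ = leastOfFirst ms λ mt → proj₂ (dominates mt (≤-antisym (proj₂ (ib mt)) (proj₁ (ib mt)))) refl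
  ... | no i≢0 | yes last = greatestOfLast ms last at-most-s
    where
      -- A member of the last block above s would have rank at least i + 1 = |⋃ D|.
      at-most-s : ∀ {t} → InBlock t D i → toℕ t ≤ toℕ s
      at-most-s {t} mt with toℕ t ≤? toℕ s
      ... | yes t≤s = t≤s
      ... | no t≰s = ⊥-elim (<-irrefl refl (begin-strict
        suc i                 ≤⟨ s≤s (bounded ms) ⟩
        suc (rank (⋃ D) s)    ≤⟨ rank-<-mono (InBlock⇒∈⋃ ms) (≰⇒> t≰s) ⟩
        rank (⋃ D) t          <⟨ rank<∣p∣ (InBlock⇒∈⋃ mt) ⟩
        ∣ ⋃ D ∣               ≡⟨ trans (balanced v) (sym last) ⟩
        suc i                 ∎))
        where open ≤-Reasoning
  ... | no i≢0 | no notLast with i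
  ...   | zero  = ⊥-elim (i≢0 refl)
  ...   | suc j = interior ms (≤∧≢⇒< (InBlock⇒<length ms) notLast)

  -- An element that drops a block was not tight, by dominance, so its bound tightens by one.
  IndexBounded-del : ∀ {D : List (Subset n)} → Valid D → ∀ I → IndexBounded D I →
                     ∀ {s i} → (adm : AdmissibleAt D s i) → Dominates D I s i → IndexBounded (del s D) I
  IndexBounded-del v I ib adm dominates mt′ with Deletion.origin v adm mt′
  ... | _ , k , mt , mv with ib mt | mv
  ... | pos , bound | stays _      = pos , bound
  ... | pos , bound | joinsRight _ = pos , bound
  ... | pos , bound | joinsLeft t<s with I _ ℕ.≟ suc k
  ...   | no It≢ = pos , ≤-pred (≤∧≢⇒< bound It≢)
  ...   | yes It≡ = ⊥-elim (<⇒≱ t<s (proj₂ (dominates mt It≡) refl))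
  IndexBounded-del v I ib adm dominates mt′ | _ , k , mt , mv | pos , bound | shifts i≤k′ with I _ ℕ.≟ suc k
  ...   | no It≢ = pos , ≤-pred (≤∧≢⇒< bound It≢)
  ...   | yes It≡ = ⊥-elim (<⇒≱ (s≤s i≤k′) (proj₁ (dominates mt It≡)))

  Realization : List (Subset n) → (Fin n → ℕ) → Set
  Realization D I = ∃ λ w → AdmissibleSeq D w × Covers w (⋃ D) × (∀ {t} → t ∈ ⋃ D → assoc t (indices D w) ≡ I t)

  Realization-extend : ∀ {D : List (Subset n)} → Valid D → ∀ {I s i} → (adm : AdmissibleAt D s i) → I s ≡ suc i →
                       Realization (del s D) I → Realization D I
  Realization-extend {D} v {I} {s} adm Is≡ (w′ , admSeq′ , cover′ , agrees′) = s ∷ w′ , adm ∷ admSeq′ , cover , agrees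
    where
      open Deletion v adm
      cover : Covers (s ∷ w′) (⋃ D)
      cover {t} t∈ with t F.≟ s
      ... | yes refl = here refl
      ... | no t≢s = there (cover′ (∈⋃D′⁺ t∈ t≢s))
      agrees : ∀ {t} → t ∈ ⋃ D → assoc t (indices D (s ∷ w′)) ≡ I t
      agrees {t} t∈ with t F.≟ s
      ... | yes refl = trans blockIndex-x (sym Is≡)
      ... | no t≢s = agrees′ (∈⋃D′⁺ t∈ t≢s)

  realization : ∀ (D : List (Subset n)) → Valid D → RankBounded D → ∀ I → IndexBounded D I → Realization D I
  realization D v bounded I ib = go (length D) D refl v bounded ib
    where
      go : ∀ ℓ (D : List (Subset n)) → length D ≡ ℓ → Valid D → RankBounded D → IndexBounded D I → Realization D I
      go zero    []      _   _ _ _ = [] , [] , (λ t∈ → ⊥-elim (∉⊥ t∈)) , (λ t∈ → ⊥-elim (∉⊥ t∈))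
      go (suc ℓ) D len v bounded ib = extend (dominating-tight v bounded I ib (subst (0 <_) (sym len) (s≤s z≤n)))
        where
          extend : (∃₂ λ s i → InBlock s D i × I s ≡ suc i × Dominates D I s i) → Realization D I
          extend (s , i , ms , Is≡ , dominates) =
            Realization-extend v adm Is≡ (go ℓ (del s D) (suc-injective (trans (length-del s D ms) len))
              (Deletion.valid v adm) (Deletion.rankBounded v adm bounded) (IndexBounded-del v I ib adm dominates))
            where
              adm : AdmissibleAt D s i
              adm = dominating-admissible v bounded I ib ms dominates

  FullyTight : List (Subset n) → List (Fin n) → Set
  FullyTight D w = ∀ {t k} → InBlock t D k → assoc t (indices D w) ≡ suc k

  FullyTight⇒stays-put : ∀ {D : List (Subset n)} → Valid D → ∀ {x i xs} → (adm : AdmissibleAt D x i) →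
                         AdmissibleSeq (del x D) xs → Covers (x ∷ xs) (⋃ D) → FullyTight D (x ∷ xs) →
                         ∀ {u k} → u ≢ x → InBlock u D k → InBlock u (del x D) k × Moves x u i k k
  FullyTight⇒stays-put {D} v {x} {i} adm admSeq cover tight {u} {k} u≢x mu with Deletion.survives v adm u≢x mu
  ... | k′ , mu′ , mv = subst (λ l → InBlock u (del x D) l × Moves x u i k l) k′≡k (mu′ , mv)
    where
      k≤k′ : k ≤ k′
      k≤k′ = ≤-pred (subst (_≤ suc k′) (trans (sym (assoc-there _ _ u≢x)) (tight mu))
               (proj₂ (index-within-block (Deletion.valid v adm) admSeq (Covers-del v adm cover (InBlock⇒∈⋃ mu′)) mu′)))
      k′≡k : k′ ≡ k
      k′≡k = ≤-antisym (Moves-≤ mv) k≤k′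

  FullyTight-del : ∀ {D : List (Subset n)} → Valid D → ∀ {x i xs} → (adm : AdmissibleAt D x i) →
                   AdmissibleSeq (del x D) xs → Covers (x ∷ xs) (⋃ D) → FullyTight D (x ∷ xs) → FullyTight (del x D) xs
  FullyTight-del {D} v {x} {i} {xs} adm admSeq cover tight {u} {k′} mu′ = from-origin (Deletion.origin v adm mu′)
    where
      from-origin : (u ≢ x × ∃ λ k → InBlock u D k × Moves x u i k k′) → assoc u (indices (del x D) xs) ≡ suc k′
      from-origin (u≢x , k , mu , _) = trans (trans (sym (assoc-there _ _ u≢x)) (tight mu)) (cong suc (sym k′≡k))
        where
          k′≡k : k′ ≡ k
          k′≡k = disjoint (Deletion.valid v adm) mu′ (proj₁ (FullyTight⇒stays-put v adm admSeq cover tight u≢x mu))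

  FullyTight⇒RankBounded : ∀ {D : List (Subset n)} → Valid D → ∀ {w} → AdmissibleSeq D w → Covers w (⋃ D) →
                           FullyTight D w → RankBounded D
  FullyTight⇒RankBounded v []             cover tight mt with cover (InBlock⇒∈⋃ mt)
  ... | ()
  FullyTight⇒RankBounded {D} v {x ∷ xs} (_∷_ {i = i} adm admSeq) cover tight = bounded
    where
      open Deletion v adm

      stays-put : ∀ {u k} → u ≢ x → InBlock u D k → InBlock u D′ k × Moves x u i k k
      stays-put = FullyTight⇒stays-put v adm admSeq cover tight

      bounded′ : RankBounded D′
      bounded′ = FullyTight⇒RankBounded valid admSeq (Covers-del v adm cover) (FullyTight-del v adm admSeq cover tight)

      x∈⋃D : x ∈ ⋃ D
      x∈⋃D = InBlock⇒∈⋃ mx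

      -- The first element above x (if any) stays in block i after deleting x, and its rank drops to that of x.
      head-bounded : i ≤ rank (⋃ D) x
      head-bounded with any? (λ u → (u ∈? ⋃ D) ×-dec (toℕ x <? toℕ u))
      ... | no nothing-above = ≤-pred (begin-strict
        i                     <⟨ InBlock⇒<length mx ⟩
        length D              ≡⟨ sym (balanced v) ⟩
        ∣ ⋃ D ∣               ≡⟨ ∣p∣≡1+rank x∈⋃D (λ {u} u∈ → ≮⇒≥ (λ x<u → nothing-above (u , u∈ , x<u))) ⟩
        suc (rank (⋃ D) x)    ∎)
        where open ≤-Reasoning
      ... | yes above with least (λ u → (u ∈? ⋃ D) ×-dec (toℕ x <? toℕ u)) above
      ...   | y , (y∈ , x<y) , next with ∈⋃⇒InBlock D y∈
      ...     | ky , my with stays-put (λ { refl → <-irrefl refl x<y }) my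
      ...       | _ , stays ky<i = ⊥-elim (<⇒≱ ky<i (Valid⇒≤-block v mx my x<y))
      ...       | my′ , joinsRight _ = begin
        i                     ≤⟨ bounded′ my′ ⟩
        rank (⋃ D′) y         ≡⟨ suc-injective (trans (sym (rank-above x<y)) y-succeeds-x) ⟩
        rank (⋃ D) x          ∎
        where
          open ≤-Reasoning
          y-succeeds-x : rank (⋃ D) y ≡ suc (rank (⋃ D) x)
          y-succeeds-x = rank-successor x∈⋃D x<y (λ u∈ x<u → next (u∈ , x<u))

      bounded : RankBounded D
      bounded {t} mt with t F.≟ x
      ... | no t≢x = ≤-trans (bounded′ (proj₁ (stays-put t≢x mt))) (rank-⊆ {t = t} (proj₁ ∘ ∈⋃D′⁻))
      ... | yes refl rewrite disjoint v mt mx = head-bounded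

module Division {n : ℕ} (C : Vec (Subset n) n) (division : IsDivision C) where

  D₀ : List (Subset n)
  D₀ = toList C

  disjoint₀ : Disjoint D₀
  disjoint₀ mt₁ mt₂ with InBlock-toList⇒∈lookup C mt₁ | InBlock-toList⇒∈lookup C mt₂
  ... | i₁ , refl , t∈₁ | i₂ , refl , t∈₂ with i₁ F.≟ i₂
  ...   | yes refl = refl
  ...   | no i₁≢i₂ = ⊥-elim (proj₁ division i₁ i₂ _ i₁≢i₂ t∈₁ t∈₂)

  ∈⋃D₀ : ∀ t → t ∈ ⋃ D₀
  ∈⋃D₀ t = let i , t∈ = proj₁ (proj₂ division) t in InBlock⇒∈⋃ (∈lookup⇒InBlock-toList C i t∈)

  valid₀ : Valid D₀
  valid₀ = record
    { disjoint = disjoint₀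
    ; ordered  = ordered₀
    ; balanced = trans (cong ∣_∣ (⊆-antisym ⊆⊤ (λ {t} _ → ∈⋃D₀ t))) (trans (∣⊤∣≡n n) (sym (length-toList C)))
    }
    where
      ordered₀ : Ordered D₀
      ordered₀ k<l ms mt with InBlock-toList⇒∈lookup C ms | InBlock-toList⇒∈lookup C mt
      ... | i , refl , s∈ | j , refl , t∈ = proj₂ (proj₂ division) i j _ _ k<l s∈ t∈

  rank₀ : ∀ t → rank (⋃ D₀) t ≡ toℕ t
  rank₀ t = trans (cong ∣_∣ (⊆-antisym (λ u∈ → proj₂ (x∈p∩q⁻ (⋃ D₀) _ u∈)) (λ {u} u∈ → x∈p∩q⁺ (∈⋃D₀ u , u∈))))
                  (∣tabulate-<ᵇ∣ (toℕ t) (<⇒≤ (toℕ<n t)))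

  ∣⋃take∣≡sum : ∀ j → ∣ ⋃ (take j D₀) ∣ ≡ sum (map ∣_∣ (take j D₀))
  ∣⋃take∣≡sum j = ∣⋃∣≡sum (take j D₀) λ m₁ m₂ → disjoint₀ (proj₁ (InBlock-take⁻ m₁)) (proj₁ (InBlock-take⁻ m₂))

  RankBounded⇒Superdiagonal : RankBounded D₀ → Superdiagonal C
  RankBounded⇒Superdiagonal bounded i = begin
    suc (toℕ i)                                         ≡⟨ sym (∣tabulate-<ᵇ∣ (suc (toℕ i)) (toℕ<n i)) ⟩
    ∣ tabulate {n = n} (λ u → toℕ u <ᵇ suc (toℕ i)) ∣   ≤⟨ p⊆q⇒∣p∣≤∣q∣ initial-segment⊆ ⟩
    ∣ ⋃ (take (suc (toℕ i)) D₀) ∣                       ≡⟨ ∣⋃take∣≡sum (suc (toℕ i)) ⟩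
    sum (map ∣_∣ (take (suc (toℕ i)) D₀))               ∎
    where
      open ≤-Reasoning
      initial-segment⊆ : tabulate (λ u → toℕ u <ᵇ suc (toℕ i)) ⊆ ⋃ (take (suc (toℕ i)) D₀)
      initial-segment⊆ {u} u∈ = let k , mu = ∈⋃⇒InBlock D₀ (∈⋃D₀ u) in
        InBlock⇒∈⋃ (InBlock-take⁺ {j = suc (toℕ i)} mu
          (≤-<-trans (subst (k ≤_) (rank₀ u) (bounded mu)) (<ᵇ⇒< _ _ (∈-tabulate⁻ u∈))))

  Superdiagonal⇒RankBounded : Superdiagonal C → RankBounded D₀
  Superdiagonal⇒RankBounded superdiagonal {t} {k} mt with k ≤? toℕ t
  ... | yes k≤t = subst (k ≤_) (sym (rank₀ t)) k≤t
  ... | no k≰t = ⊥-elim (1+n≰n (begin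
    suc (toℕ t)                            ≤⟨ superdiagonal t ⟩
    sum (map ∣_∣ (take (suc (toℕ t)) D₀))  ≡⟨ sym (∣⋃take∣≡sum (suc (toℕ t))) ⟩
    ∣ ⋃ (take (suc (toℕ t)) D₀) ∣          ≤⟨ p⊆q⇒∣p∣≤∣q∣ ⋃take⊆below ⟩
    ∣ below t ∣                            ≡⟨ ∣tabulate-<ᵇ∣ (toℕ t) (<⇒≤ (toℕ<n t)) ⟩
    toℕ t                                  ∎))
    where
      open ≤-Reasoning
      ⋃take⊆below : ⋃ (take (suc (toℕ t)) D₀) ⊆ below t
      ⋃take⊆below u∈ = let _ , mu = ∈⋃⇒InBlock (take (suc (toℕ t)) D₀) u∈ ; mu₀ , ku≤t = InBlock-take⁻ mu in
        ∈below⁺ (ordered valid₀ (≤-<-trans (≤-pred ku≤t) (≰⇒> k≰t)) mu₀ mt)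

  IsIndexFn⇒IndexBounded : ∀ {I} → IsIndexFn C I → IndexBounded D₀ I
  IsIndexFn⇒IndexBounded isIndexFn mt with InBlock-toList⇒∈lookup C mt
  ... | i , refl , t∈ = isIndexFn i _ t∈

  CPerm⇒AdmissibleSeq : ∀ {w} → CPerm C w → AdmissibleSeq D₀ w × Covers w (⋃ D₀)
  CPerm⇒AdmissibleSeq {w} (w↭allFin , admissible) =
    AdmissibleSeq⁺ D₀ w admissible , λ {t} _ → ∈-resp-↭ (↭-sym w↭allFin) (∈-allFin t)

  AdmissibleSeq⇒CPerm : ∀ {w} → AdmissibleSeq D₀ w → Covers w (⋃ D₀) → CPerm C w
  AdmissibleSeq⇒CPerm admSeq cover =
    Unique-⇔⇒↭ F._≟_ (AdmissibleSeq⇒Unique valid₀ admSeq) (allFin⁺ n)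
      (λ {t} _ → ∈-allFin t) (λ {t} _ → cover (∈⋃D₀ t)) ,
    AdmissibleSeq⁻ admSeq

  index-function : ∀ w → CPerm C w → IsIndexFn C (IFun C w)
  index-function w cperm i s s∈ =
    let admSeq , cover = CPerm⇒AdmissibleSeq cperm
    in index-within-block valid₀ admSeq (cover (∈⋃D₀ s)) (∈lookup⇒InBlock-toList C i s∈)

  injective : MapInjective C
  injective w w′ cperm cperm′ same =
    let admSeq , cover = CPerm⇒AdmissibleSeq cperm ; admSeq′ , cover′ = CPerm⇒AdmissibleSeq cperm′
    in AdmissibleSeq-injective valid₀ admSeq admSeq′ cover cover′ same

  surjective⇒superdiagonal : MapSurjective C → Superdiagonal C
  surjective⇒superdiagonal surjective with surjective (λ t → blockIndex t D₀) isIndexFn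
    where
      isIndexFn : IsIndexFn C (λ t → blockIndex t D₀)
      isIndexFn i s s∈ rewrite blockIndex-InBlock disjoint₀ (∈lookup⇒InBlock-toList C i s∈) = s≤s z≤n , ≤-refl
  ... | w , cperm , realizes =
    let admSeq , cover = CPerm⇒AdmissibleSeq cperm
    in RankBounded⇒Superdiagonal (FullyTight⇒RankBounded valid₀ admSeq cover
         λ {t} mt → trans (realizes t) (blockIndex-InBlock disjoint₀ mt))

  superdiagonal⇒surjective : Superdiagonal C → MapSurjective C
  superdiagonal⇒surjective superdiagonal I isIndexFn =
    let w , admSeq , cover , realizes =
          realization D₀ valid₀ (Superdiagonal⇒RankBounded superdiagonal) I (IsIndexFn⇒IndexBounded isIndexFn)
    in w , AdmissibleSeq⇒CPerm admSeq cover , λ t → realizes (∈⋃D₀ t)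

mainTheorem8 : (n : ℕ) → 1 ≤ n → (C : Vec (Subset n) n) → IsDivision C →
    ((w : List (Fin n)) → CPerm C w → IsIndexFn C (IFun C w))
    × (MapInjective C
    × (((MapInjective C × MapSurjective C) → Superdiagonal C)
      × (Superdiagonal C → (MapInjective C × MapSurjective C))))
mainTheorem8 n _ C division =
  index-function , injective , surjective⇒superdiagonal ∘ proj₂ ,
  λ superdiagonal → injective , superdiagonal⇒surjective superdiagonal
  where open Division C division
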